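{- For every positive integer $n$: (1) if $2n-1\leq t\leq 4n-3$, then $K_{2n-1}\in\mathfrak{T}_t$; (2) if $3n\leq t\leq 4n-1$, then $K_{2n}\in\mathfrak{T}_t$.
   Context: All graphs are finite, undirected, without loops or multiple edges; $K_m$ is the complete graph on $m$ vertices. A total coloring of a graph $G$ is an assignment of colors to the vertices and edges of $G$ such that no two adjacent vertices, no two adjacent edges, and no vertex and an edge incident to it receive the same color. For a positive integer $t$, an interval total $t$-coloring of $G$ is a total coloring of $G$ with colors $1,2,\ldots,t$ such that each color $i\in\{1,\ldots,t\}$ is used on at least one vertex or edge, and for each vertex $v$ the set consisting of the color of $v$ and the colors of the edges incident to $v$ consists of $d_G(v)+1$ consecutive integers, where $d_G(v)$ is the degree of $v$. $\mathfrak{T}_t$ denotes the set of graphs having an interval total $t$-coloring. -}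

module Defs where

open import Data.Nat using (ℕ; zero; suc; _+_; _*_; _∸_; _≤_; _<_)
open import Data.Fin using (Fin)
open import Data.Fin.Properties using (_≟_)
open import Data.List using (List; filter; length; allFin)
open import Data.Product using (Σ; ∃; ∃-syntax; _×_; _,_)
open import Data.Sum using (_⊎_)
open import Relation.Nullary using (¬_; Dec; ¬?)
open import Relation.Binary.PropositionalEquality using (_≡_; _≢_)

record Graph : Set₁ where
  field
    m      : ℕ
    Adj    : Fin m → Fin m → Set
    Adj?   : ∀ u v → Dec (Adj u v)
    sym    : ∀ {u v} → Adj u v → Adj v u
    irrefl : ∀ {u} → ¬ Adj u u

open Graph public

degree : (G : Graph) → Fin (m G) → ℕ
degree G v = length (filter (Adj? G v) (allFin (m G)))

K : ℕ → Graph
K n = record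
  { m      = n
  ; Adj    = λ u v → u ≢ v
  ; Adj?   = λ u v → ¬? (u ≟ v)
  ; sym    = λ p q → p (Relation.Binary.PropositionalEquality.sym q)
  ; irrefl = λ p → p Relation.Binary.PropositionalEquality.refl
  }

-- a color assignment to vertices and edges (edge colors given for each
-- ordered adjacent pair, required to agree in both directions)
record TotalAssignment (G : Graph) : Set where
  field
    vcol : Fin (m G) → ℕ
    ecol : ∀ u v → Adj G u v → ℕ

open TotalAssignment public

AtVertex : (G : Graph) → TotalAssignment G → Fin (m G) → ℕ → Set
AtVertex G f v c = (vcol f v ≡ c) ⊎ (∃[ u ] Σ (Adj G v u) λ a → ecol f v u a ≡ c)

Used : (G : Graph) → TotalAssignment G → ℕ → Set
Used G f c = (∃[ v ] vcol f v ≡ c) ⊎ (∃[ u ] ∃[ v ] Σ (Adj G u v) λ a → ecol f u v a ≡ c)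

record IsIntervalTotalColoring (G : Graph) (t : ℕ) (f : TotalAssignment G) : Set where
  field
    ecol-sym   : ∀ u v (a : Adj G u v) → ecol f u v a ≡ ecol f v u (sym G a)
    vcol-range : ∀ v → 1 ≤ vcol f v × vcol f v ≤ t
    ecol-range : ∀ u v (a : Adj G u v) → 1 ≤ ecol f u v a × ecol f u v a ≤ t
    adj-vert   : ∀ u v → Adj G u v → vcol f u ≢ vcol f v
    adj-edge   : ∀ v u w (a : Adj G v u) (b : Adj G v w) → u ≢ w → ecol f v u a ≢ ecol f v w b
    inc        : ∀ v u (a : Adj G v u) → vcol f v ≢ ecol f v u a
    surj       : ∀ c → 1 ≤ c → c ≤ t → Used G f c
    interval   : ∀ v → ∃[ s ] ((∀ c → AtVertex G f v c → s ≤ c × c ≤ s + degree G v)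
                              × (∀ c → s ≤ c → c ≤ s + degree G v → AtVertex G f v c))

-- 𝔗_t : graphs admitting an interval total t-coloring
InT : ℕ → Graph → Set
InT t G = Σ (TotalAssignment G) (IsIntervalTotalColoring G t)

-- Number the vertices of K m by 0, …, m - 1 and give vertex i and edge ij a colour
-- c (i + j) depending only on the sum, so that vertex i sees the colours of the window
-- of sums i, …, i + m - 1.  Mark some positions p < m, κ of them, and let base rank the
-- marked positions by 0, …, κ - 1 and the unmarked ones by κ, …, m - 1.  Put
-- c s = base s for s < m, and c (p + m) = base p + m or base p as p is marked or not.
-- Moving the window from i to i + 1 trades base i for c (i + m), i.e. lifts it by m
-- exactly when i is marked, so the window of vertex i is the interval starting at the
-- number of marked positions below i, and all of 0, …, κ + m - 1 occur once the last
-- position is unmarked.  What remains is to make the vertex colours c (2i) distinct.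
-- For m = 2n - 1 mark the first e ≤ 2n - 2 positions: c s ≡ s modulo the odd m.
-- For m = 2n mark the first 2k < 2n positions and the even ones after them: then all
-- sums 2i are marked, κ = n + k and t = 3n + k.

module Submission where

open import Defs hiding (sym; m)
open import Data.Bool using (Bool; true; false; not; _∨_; if_then_else_)
open import Data.Bool.Properties using (not-involutive; ∨-zeroʳ)
open import Data.Nat using (ℕ; zero; suc; _+_; _*_; _∸_; _⊓_; _≤_; _<_; z≤n; s≤s; s≤s⁻¹; z<s; _<?_)
open import Data.Nat.Properties
open import Data.Fin as Fin using (Fin; toℕ; fromℕ<; punchOut)
open import Data.Fin.Properties as Finₚ using (toℕ-injective; toℕ<n; toℕ-fromℕ<; punchOut-injective; injective⇒≤)
open import Data.List using (_∷_; filter; length; tabulate)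
open import Data.List.Properties using (filter-accept; filter-reject; filter-all; length-tabulate)
open import Data.List.Relation.Unary.All.Properties using (tabulate⁺)
open import Data.Product using (∃; ∃₂; _×_; _,_; proj₁; proj₂)
open import Data.Sum using (_⊎_; inj₁; inj₂)
open import Function using (_∘_)
open import Function.Definitions using (Injective; StrictlySurjective)
open import Relation.Nullary using (does; yes; no; ¬?; contradiction)
open import Relation.Nullary.Decidable using (dec-true; dec-false)
open import Relation.Binary.PropositionalEquality
open import Relation.Binary.Definitions using (tri<; tri≈; tri>)
open import Data.Nat.Tactic.RingSolver using (solve-∀)

open ≡-Reasoning

surjective⇒injective : ∀ {m} (h : Fin m → Fin m) → StrictlySurjective _≡_ h → Injective _≡_ _≡_ h
surjective⇒injective {zero} h onto {()}
surjective⇒injective {suc m} h onto {x} {y} hx≡hy with x Fin.≟ y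
... | yes x≡y = x≡y
... | no x≢y = contradiction (injective⇒≤ reduced-injective) (1+n≰n {m})
  where
  -- a right inverse of h that avoids x, using y in its place
  section : Fin (suc m) → Fin (suc m)
  section z with proj₁ (onto z) Fin.≟ x
  ... | yes _ = y
  ... | no _  = proj₁ (onto z)

  h∘section : ∀ z → h (section z) ≡ z
  h∘section z with proj₁ (onto z) Fin.≟ x
  ... | yes refl = trans (sym hx≡hy) (proj₂ (onto z))
  ... | no _     = proj₂ (onto z)

  x≢section : ∀ z → x ≢ section z
  x≢section z with proj₁ (onto z) Fin.≟ x
  ... | yes _ = x≢y
  ... | no ≢x = ≢x ∘ sym

  reduced : Fin (suc m) → Fin m
  reduced z = punchOut (x≢section z)

  reduced-injective : Injective _≡_ _≡_ reduced
  reduced-injective {a} {b} eq = begin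
    a               ≡⟨ sym (h∘section a) ⟩
    h (section a)   ≡⟨ cong h (punchOut-injective (x≢section a) (x≢section b) eq) ⟩
    h (section b)   ≡⟨ h∘section b ⟩
    b               ∎

length-filter-≢-tabulate : ∀ {k n} (h : Fin k → Fin n) → Injective _≡_ _≡_ h →
                           ∀ i → suc (length (filter (¬? ∘ (h i Fin.≟_)) (tabulate h))) ≡ k
length-filter-≢-tabulate {suc k} h h-inj Fin.zero = begin
  suc (length (filter P? (h Fin.zero ∷ tabulate (h ∘ Fin.suc))))
    ≡⟨ cong (suc ∘ length) (filter-reject P? (λ h0≢h0 → h0≢h0 refl)) ⟩
  suc (length (filter P? (tabulate (h ∘ Fin.suc))))
    ≡⟨ cong (suc ∘ length) (filter-all P? (tabulate⁺ {f = h ∘ Fin.suc} (λ j eq → 0≢suc (h-inj eq)))) ⟩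
  suc (length (tabulate (h ∘ Fin.suc)))
    ≡⟨ cong suc (length-tabulate (h ∘ Fin.suc)) ⟩
  suc k ∎
  where
  P? = ¬? ∘ (h Fin.zero Fin.≟_)
  0≢suc : ∀ {j} → Fin.zero ≢ Fin.suc {k} j
  0≢suc ()
length-filter-≢-tabulate {suc k} h h-inj (Fin.suc i) = begin
  suc (length (filter P? (h Fin.zero ∷ tabulate (h ∘ Fin.suc))))
    ≡⟨ cong (suc ∘ length) (filter-accept P? (λ eq → suc≢0 (h-inj eq))) ⟩
  suc (suc (length (filter P? (tabulate (h ∘ Fin.suc)))))
    ≡⟨ cong suc (length-filter-≢-tabulate (h ∘ Fin.suc) (Finₚ.suc-injective ∘ h-inj) i) ⟩
  suc k ∎
  where
  P? = ¬? ∘ (h (Fin.suc i) Fin.≟_)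
  suc≢0 : Fin.suc i ≢ Fin.zero
  suc≢0 ()

suc-degree-K : ∀ m (v : Fin m) → suc (degree (K m) v) ≡ m
suc-degree-K m v = length-filter-≢-tabulate (λ u → u) (λ eq → eq) v

fromℕ<-injective : ∀ {i j n} (i<n : i < n) (j<n : j < n) → fromℕ< i<n ≡ fromℕ< j<n → i ≡ j
fromℕ<-injective i<n j<n eq = trans (sym (toℕ-fromℕ< i<n)) (trans (cong toℕ eq) (toℕ-fromℕ< j<n))

∸-<-from : ∀ {a y m} → a ≤ y → y < a + m → y ∸ a < m
∸-<-from {a} {y} {m} a≤y y<a+m = subst (y ∸ a <_) (m+n∸m≡n a m) (∸-monoˡ-< y<a+m a≤y)

onto-below⇒injective-below : ∀ {m} (f : ℕ → ℕ) → (∀ {u} → u < m → f u < m) →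
                             (∀ {y} → y < m → ∃ λ u → u < m × f u ≡ y) →
                             ∀ {u w} → u < m → w < m → f u ≡ f w → u ≡ w
onto-below⇒injective-below {m} f f< onto {u} {w} u<m w<m fu≡fw =
  fromℕ<-injective u<m w<m (surjective⇒injective h h-onto (toℕ-injective h-eq))
  where
  h : Fin m → Fin m
  h u = fromℕ< (f< (toℕ<n u))

  toℕ-h : ∀ {u} (u<m : u < m) → toℕ (h (fromℕ< u<m)) ≡ f u
  toℕ-h u<m = trans (toℕ-fromℕ< _) (cong f (toℕ-fromℕ< u<m))

  h-eq : toℕ (h (fromℕ< u<m)) ≡ toℕ (h (fromℕ< w<m))
  h-eq = trans (toℕ-h u<m) (trans fu≡fw (sym (toℕ-h w<m)))

  h-onto : StrictlySurjective _≡_ h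
  h-onto y with onto (toℕ<n y)
  ... | x , x<m , fx≡y = fromℕ< x<m , toℕ-injective (trans (toℕ-h x<m) fx≡y)

record WindowColouring (m t : ℕ) : Set where
  field
    colour start       : ℕ → ℕ
    window-bounds      : ∀ {i u} → i < m → u < m →
                         start i ≤ colour (i + u) × colour (i + u) < start i + m
    window-onto        : ∀ {i x} → i < m → x < m →
                         ∃ λ u → u < m × colour (i + u) ≡ start i + x
    diagonal-injective : ∀ {i j} → i < m → j < m → colour (i + i) ≡ colour (j + j) → i ≡ j
    colour-<           : ∀ {i j} → i < m → j < m → colour (i + j) < t
    colour-onto        : ∀ {x} → x < t → ∃₂ λ i j → i < m × j < m × colour (i + j) ≡ x

module _ {m t : ℕ} (W : WindowColouring m t) where
  open WindowColouring W

  window-injective : ∀ {i u w} → i < m → u < m → w < m →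
                     colour (i + u) ≡ colour (i + w) → u ≡ w
  window-injective {i} i<m u<m w<m eq =
    onto-below⇒injective-below offset offset< offset-onto u<m w<m (cong (_∸ start i) eq)
    where
    offset : ℕ → ℕ
    offset u = colour (i + u) ∸ start i

    offset< : ∀ {u} → u < m → offset u < m
    offset< u<m = let lo , hi = window-bounds i<m u<m in ∸-<-from lo hi

    offset-onto : ∀ {x} → x < m → ∃ λ u → u < m × offset u ≡ x
    offset-onto {x} x<m with window-onto i<m x<m
    ... | u , u<m , eq = u , u<m , trans (cong (_∸ start i) eq) (m+n∸m≡n (start i) x)

  assignment : TotalAssignment (K m)
  assignment = record
    { vcol = λ v → suc (colour (toℕ v + toℕ v))
    ; ecol = λ u v _ → suc (colour (toℕ u + toℕ v))
    }

  atVertex : ∀ v u → AtVertex (K m) assignment v (suc (colour (toℕ v + toℕ u)))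
  atVertex v u with v Fin.≟ u
  ... | yes refl = inj₁ refl
  ... | no v≢u   = inj₂ (u , v≢u , refl)

  atVertex-inv : ∀ v {c} → AtVertex (K m) assignment v c →
                 ∃ λ u → suc (colour (toℕ v + toℕ u)) ≡ c
  atVertex-inv v (inj₁ eq)           = v , eq
  atVertex-inv v (inj₂ (u , _ , eq)) = u , eq

  isInterval : IsIntervalTotalColoring (K m) t assignment
  isInterval = record
    { ecol-sym   = λ u v _ → cong (suc ∘ colour) (+-comm (toℕ u) (toℕ v))
    ; vcol-range = λ v → s≤s z≤n , colour-< (toℕ<n v) (toℕ<n v)
    ; ecol-range = λ u v _ → s≤s z≤n , colour-< (toℕ<n u) (toℕ<n v)
    ; adj-vert   = λ u v u≢v eq →
        u≢v (toℕ-injective (diagonal-injective (toℕ<n u) (toℕ<n v) (suc-injective eq)))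
    ; adj-edge   = λ v u w _ _ u≢w eq →
        u≢w (toℕ-injective (window-injective (toℕ<n v) (toℕ<n u) (toℕ<n w) (suc-injective eq)))
    ; inc        = λ v u v≢u eq →
        v≢u (toℕ-injective (window-injective (toℕ<n v) (toℕ<n v) (toℕ<n u) (suc-injective eq)))
    ; surj       = used
    ; interval   = interval
    }
    where
    used : ∀ c → 1 ≤ c → c ≤ t → Used (K m) assignment c
    used (suc x) _ x<t with colour-onto x<t
    ... | i , j , i<m , j<m , eq with i ≟ j
    ... | yes refl = inj₁ (fromℕ< i<m , cong suc (trans (cong (λ z → colour (z + z)) (toℕ-fromℕ< i<m)) eq))
    ... | no i≢j   = inj₂ (fromℕ< i<m , fromℕ< j<m , i≢j ∘ fromℕ<-injective i<m j<m ,
                           cong suc (trans (cong₂ (λ a b → colour (a + b)) (toℕ-fromℕ< i<m) (toℕ-fromℕ< j<m)) eq))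

    interval : ∀ v → ∃ λ s →
                 (∀ c → AtVertex (K m) assignment v c → s ≤ c × c ≤ s + degree (K m) v)
               × (∀ c → s ≤ c → c ≤ s + degree (K m) v → AtVertex (K m) assignment v c)
    interval v = suc (start i) , bounds , cover
      where
      i = toℕ v
      At = AtVertex (K m) assignment v

      top : suc (start i) + degree (K m) v ≡ start i + m
      top = trans (sym (+-suc (start i) _)) (cong (start i +_) (suc-degree-K m v))

      bounds : ∀ c → At c → suc (start i) ≤ c × c ≤ suc (start i) + degree (K m) v
      bounds c at with u , refl ← atVertex-inv v at =
        let lo , hi = window-bounds (toℕ<n v) (toℕ<n u)
        in s≤s lo , subst (suc (colour (i + toℕ u)) ≤_) (sym top) hi

      cover : ∀ c → suc (start i) ≤ c → c ≤ suc (start i) + degree (K m) v → At c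
      cover (suc y) (s≤s start≤y) y<top
        with u , u<m , eq ← window-onto (toℕ<n v) (∸-<-from start≤y (subst (y <_) top y<top)) =
        subst At (cong suc (begin
          colour (i + toℕ (fromℕ< u<m)) ≡⟨ cong (λ z → colour (i + z)) (toℕ-fromℕ< u<m) ⟩
          colour (i + u)                ≡⟨ eq ⟩
          start i + (y ∸ start i)       ≡⟨ m+[n∸m]≡n start≤y ⟩
          y                             ∎))
          (atVertex v (fromℕ< u<m))

  windowColouring⇒InT : InT t (K m)
  windowColouring⇒InT = assignment , isInterval

count : (ℕ → Bool) → ℕ → ℕ
count ε zero    = zero
count ε (suc p) = if ε p then suc (count ε p) else count ε p

module _ (ε : ℕ → Bool) where

  count-true : ∀ {p} → ε p ≡ true → count ε (suc p) ≡ suc (count ε p)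
  count-true eq rewrite eq = refl

  count-false : ∀ {p} → ε p ≡ false → count ε (suc p) ≡ count ε p
  count-false eq rewrite eq = refl

  count-≤-count-suc : ∀ p → count ε p ≤ count ε (suc p)
  count-≤-count-suc p with ε p
  ... | true  = n≤1+n (count ε p)
  ... | false = ≤-refl

  count-suc-≤ : ∀ p → count ε (suc p) ≤ suc (count ε p)
  count-suc-≤ p with ε p
  ... | true  = ≤-refl
  ... | false = n≤1+n (count ε p)

  count-≤ : ∀ p → count ε p ≤ p
  count-≤ zero    = z≤n
  count-≤ (suc p) = ≤-trans (count-suc-≤ p) (s≤s (count-≤ p))

  count-mono : ∀ {p q} → p ≤ q → count ε p ≤ count ε q
  count-mono {q = zero} z≤n = z≤n
  count-mono {p} {suc q} p≤q with m≤n⇒m<n∨m≡n p≤q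
  ... | inj₁ p<q  = ≤-trans (count-mono (s≤s⁻¹ p<q)) (count-≤-count-suc q)
  ... | inj₂ refl = ≤-refl

  count-strict : ∀ {p q} → p < q → ε p ≡ true → count ε p < count ε q
  count-strict p<q εp = subst (_≤ _) (count-true εp) (count-mono p<q)

  count-injective : ∀ {p q} → ε p ≡ true → ε q ≡ true → count ε p ≡ count ε q → p ≡ q
  count-injective {p} {q} εp εq eq with <-cmp p q
  ... | tri< p<q _ _ = contradiction eq (<⇒≢ (count-strict p<q εp))
  ... | tri≈ _ p≡q _ = p≡q
  ... | tri> _ _ q<p = contradiction (sym eq) (<⇒≢ (count-strict q<p εq))

  count-+ : ∀ p u → count ε (p + u) ≤ count ε p + u
  count-+ p zero    rewrite +-identityʳ p | +-identityʳ (count ε p) = ≤-refl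
  count-+ p (suc u) rewrite +-suc p u | +-suc (count ε p) u =
    ≤-trans (count-suc-≤ (p + u)) (s≤s (count-+ p u))

  count-onto : ∀ {y} q → y < count ε q → ∃ λ p → p < q × ε p ≡ true × count ε p ≡ y
  count-onto {y} (suc q) y<count with ε q in εq
  ... | true with m≤n⇒m<n∨m≡n (s≤s⁻¹ y<count)
  ...   | inj₂ refl = q , ≤-refl , εq , refl
  ...   | inj₁ y<c  = let p , p<q , εp , eq = count-onto q y<c in p , m≤n⇒m≤1+n p<q , εp , eq
  count-onto (suc q) y<count | false =
    let p , p<q , εp , eq = count-onto q y<count in p , m≤n⇒m≤1+n p<q , εp , eq

  count-all : ∀ {q} → (∀ {p} → p < q → ε p ≡ true) → count ε q ≡ q
  count-all {zero}  _   = refl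
  count-all {suc q} all = trans (count-true (all ≤-refl)) (cong suc (count-all (all ∘ m≤n⇒m≤1+n)))

  count-+-count-not : ∀ p → count ε p + count (not ∘ ε) p ≡ p
  count-+-count-not zero = refl
  count-+-count-not (suc p) with ε p
  ... | true  = cong suc (count-+-count-not p)
  ... | false = trans (+-suc (count ε p) _) (cong suc (count-+-count-not p))

module ShiftColouring (l : ℕ) (ε : ℕ → Bool) where

  m : ℕ
  m = suc l

  κ : ℕ
  κ = count ε m

  base : ℕ → ℕ
  base p = if ε p then count ε p else κ + count (not ∘ ε) p

  lift : ℕ → ℕ
  lift p = if ε p then m else 0

  colour : ℕ → ℕ
  colour s with m ≤? s
  ... | no _  = base s
  ... | yes _ = base (s ∸ m) + lift (s ∸ m)

  base-marked : ∀ {p} → ε p ≡ true → base p ≡ count ε p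
  base-marked εp rewrite εp = refl

  base-unmarked : ∀ {p} → ε p ≡ false → base p ≡ κ + count (not ∘ ε) p
  base-unmarked εp rewrite εp = refl

  colour-low : ∀ {s} → s < m → colour s ≡ base s
  colour-low {s} s<m with m ≤? s
  ... | no _    = refl
  ... | yes m≤s = contradiction s<m (≤⇒≯ m≤s)

  colour-high : ∀ p → colour (p + m) ≡ base p + lift p
  colour-high p with m ≤? p + m
  ... | no m≰p+m = contradiction (m≤n+m m p) m≰p+m
  ... | yes _    = cong (λ q → base q + lift q) (m+n∸n≡m p m)

  colour-high-marked : ∀ {p} → ε p ≡ true → colour (p + m) ≡ count ε p + m
  colour-high-marked {p} εp rewrite colour-high p | εp = refl

  colour-high-unmarked : ∀ {p} → ε p ≡ false → colour (p + m) ≡ base p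
  colour-high-unmarked {p} εp rewrite colour-high p | εp = +-identityʳ _

  κ-+-count-not : κ + count (not ∘ ε) m ≡ m
  κ-+-count-not = count-+-count-not ε m

  base-unmarked-bounds : ∀ {p} → p < m → ε p ≡ false → κ ≤ base p × base p < m
  base-unmarked-bounds {p} p<m εp rewrite base-unmarked εp =
    m≤m+n κ _ , subst (κ + count (not ∘ ε) p <_) κ-+-count-not
                      (+-monoʳ-< κ (count-strict (not ∘ ε) p<m (cong not εp)))

  base-onto : ∀ {y} → y < m → ∃ λ p → p < m × base p ≡ y
  base-onto {y} y<m with y <? κ
  ... | yes y<κ = let p , p<m , εp , eq = count-onto ε m y<κ in p , p<m , trans (base-marked εp) eq
  ... | no y≮κ  =
    let p , p<m , ¬εp , eq = count-onto (not ∘ ε) m (∸-<-from κ≤y (subst (y <_) (sym κ-+-count-not) y<m))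
    in p , p<m , trans (base-unmarked (not-true ¬εp)) (trans (cong (κ +_) eq) (m+[n∸m]≡n κ≤y))
    where
    κ≤y = ≮⇒≥ y≮κ
    not-true : ∀ {b} → not b ≡ true → b ≡ false
    not-true {false} _ = refl

  marked-or-unmarked : ∀ p → ε p ≡ true ⊎ ε p ≡ false
  marked-or-unmarked p with ε p
  ... | true  = inj₁ refl
  ... | false = inj₂ refl

  low-or-high : ∀ s → s < m ⊎ ∃ λ p → s ≡ p + m
  low-or-high s with s <? m
  ... | yes s<m = inj₁ s<m
  ... | no s≮m  = inj₂ (s ∸ m , sym (m∸n+n≡m (≮⇒≥ s≮m)))

  wrap-around : ∀ {p i} → p < i → i < m → p + m ∸ i < m × i + (p + m ∸ i) ≡ p + m
  wrap-around {p} {i} p<i i<m =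
    ∸-<-from i≤p+m (+-monoˡ-< m p<i) , m+[n∸m]≡n i≤p+m
    where
    i≤p+m : i ≤ p + m
    i≤p+m = ≤-trans (<⇒≤ i<m) (m≤n+m m p)

  high-below : ∀ {i u p} → u < m → i + u ≡ p + m → p < i
  high-below {i} u<m i+u≡p+m = +-cancelʳ-< m _ i (subst (_< i + m) i+u≡p+m (+-monoʳ-< i u<m))

  unmarked-in-window : ∀ {i p} → i ≤ m → p < m → ε p ≡ false →
                       count ε i ≤ base p × base p < count ε i + m
  unmarked-in-window {i} i≤m p<m εp =
    let lo , hi = base-unmarked-bounds p<m εp
    in ≤-trans (count-mono ε i≤m) lo , <-≤-trans hi (m≤n+m m (count ε i))

  window-bounds : ∀ {i u} → i < m → u < m →
                  count ε i ≤ colour (i + u) × colour (i + u) < count ε i + m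
  window-bounds {i} {u} i<m u<m with low-or-high (i + u)
  ... | inj₁ s<m rewrite colour-low s<m with marked-or-unmarked (i + u)
  ...   | inj₁ εs rewrite base-marked εs =
          count-mono ε (m≤m+n i u) , ≤-<-trans (count-+ ε i u) (+-monoʳ-< (count ε i) u<m)
  ...   | inj₂ εs = unmarked-in-window (<⇒≤ i<m) s<m εs
  window-bounds {i} {u} i<m u<m | inj₂ (p , s≡p+m) rewrite s≡p+m with marked-or-unmarked p
  ...   | inj₁ εp rewrite colour-high-marked εp =
          ≤-trans (count-≤ ε i) (≤-trans (<⇒≤ i<m) (m≤n+m m (count ε p))) ,
          +-monoˡ-< m (count-strict ε (high-below u<m s≡p+m) εp)
  ...   | inj₂ εp rewrite colour-high-unmarked εp =
          unmarked-in-window (<⇒≤ i<m) (<-trans (high-below u<m s≡p+m) i<m) εp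

  window-onto-low : ∀ {i y} → i < m → count ε i ≤ y → y < m → ∃ λ u → u < m × colour (i + u) ≡ y
  window-onto-low {i} {y} i<m count≤y y<m with p , p<m , base-p≡y ← base-onto y<m with i ≤? p
  ... | yes i≤p = p ∸ i , ≤-<-trans (m∸n≤m p i) p<m , (begin
    colour (i + (p ∸ i)) ≡⟨ cong colour (m+[n∸m]≡n i≤p) ⟩
    colour p             ≡⟨ colour-low p<m ⟩
    base p               ≡⟨ base-p≡y ⟩
    y                    ∎)
  ... | no i≰p with marked-or-unmarked p
  ...   | inj₁ εp = contradiction (trans (sym (base-marked εp)) base-p≡y)
                                  (<⇒≢ (<-≤-trans (count-strict ε (≰⇒> i≰p) εp) count≤y))
  ...   | inj₂ εp = let u<m , i+u≡p+m = wrap-around (≰⇒> i≰p) i<m in p + m ∸ i , u<m , (begin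
    colour (i + (p + m ∸ i)) ≡⟨ cong colour i+u≡p+m ⟩
    colour (p + m)           ≡⟨ colour-high-unmarked εp ⟩
    base p                   ≡⟨ base-p≡y ⟩
    y                        ∎)

  window-onto-high : ∀ {i y} → i < m → m ≤ y → y < count ε i + m → ∃ λ u → u < m × colour (i + u) ≡ y
  window-onto-high {i} {y} i<m m≤y y<count+m
    with p , p<i , εp , count-p≡ ← count-onto ε i
                                     (∸-<-from m≤y (subst (y <_) (+-comm (count ε i) m) y<count+m)) =
    let u<m , i+u≡p+m = wrap-around p<i i<m in p + m ∸ i , u<m , (begin
      colour (i + (p + m ∸ i)) ≡⟨ cong colour i+u≡p+m ⟩
      colour (p + m)           ≡⟨ colour-high-marked εp ⟩
      count ε p + m            ≡⟨ cong (_+ m) count-p≡ ⟩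
      y ∸ m + m                ≡⟨ m∸n+n≡m m≤y ⟩
      y                        ∎)

  window-onto : ∀ {i x} → i < m → x < m → ∃ λ u → u < m × colour (i + u) ≡ count ε i + x
  window-onto {i} {x} i<m x<m with count ε i + x <? m
  ... | yes y<m = window-onto-low i<m (m≤m+n (count ε i) x) y<m
  ... | no y≮m  = window-onto-high i<m (≮⇒≥ y≮m) (+-monoʳ-< (count ε i) x<m)

  colour-< : ∀ {i j} → i < m → j < m → colour (i + j) < κ + m
  colour-< i<m j<m = <-≤-trans (proj₂ (window-bounds i<m j<m)) (+-monoˡ-≤ m (count-mono ε (<⇒≤ i<m)))

  colour-onto : ε l ≡ false → ∀ {x} → x < κ + m → ∃₂ λ i j → i < m × j < m × colour (i + j) ≡ x
  colour-onto εl {x} x<κ+m with x <? m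
  ... | yes x<m = let u , u<m , eq = window-onto-low z<s z≤n x<m in 0 , u , z<s , u<m , eq
  ... | no x≮m  =
    let u , u<m , eq = window-onto-high ≤-refl (≮⇒≥ x≮m) (subst (λ c → x < c + m) (count-false ε εl) x<κ+m)
    in l , u , ≤-refl , u<m , eq

  shiftColouring : ε l ≡ false →
                   (∀ {i j} → i < m → j < m → colour (i + i) ≡ colour (j + j) → i ≡ j) →
                   WindowColouring m (κ + m)
  shiftColouring εl diagonal-injective = record
    { colour             = colour
    ; start              = count ε
    ; window-bounds      = window-bounds
    ; window-onto        = window-onto
    ; diagonal-injective = diagonal-injective
    ; colour-<           = colour-<
    ; colour-onto        = colour-onto εl
    }

double-injective : ∀ {i j} → i + i ≡ j + j → i ≡ j
double-injective {i} {j} eq = *-cancelˡ-≡ i j 2 (begin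
  2 * i   ≡⟨ cong (i +_) (+-identityʳ i) ⟩
  i + i   ≡⟨ eq ⟩
  j + j   ≡⟨ cong (j +_) (+-identityʳ j) ⟨
  2 * j   ∎)

double≢suc-double : ∀ i j → i + i ≢ suc (j + j)
double≢suc-double i j eq = even≢odd i j (begin
  2 * i         ≡⟨ cong (i +_) (+-identityʳ i) ⟩
  i + i         ≡⟨ eq ⟩
  suc (j + j)   ≡⟨ cong (suc ∘ (j +_)) (+-identityʳ j) ⟨
  suc (2 * j)   ∎)

module OddComplete (a e : ℕ) (e≤2a : e ≤ a + a) where

  below : ℕ → Bool
  below p = does (p <? e)

  open ShiftColouring (a + a) below

  <⇒marked : ∀ {p} → p < e → below p ≡ true
  <⇒marked {p} = dec-true (p <? e)

  ≥⇒unmarked : ∀ {p} → e ≤ p → below p ≡ false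
  ≥⇒unmarked {p} e≤p = dec-false (p <? e) (≤⇒≯ e≤p)

  marked⇒< : ∀ {p} → below p ≡ true → p < e
  marked⇒< marked = ≰⇒> (λ e≤p → contradiction (trans (sym marked) (≥⇒unmarked e≤p)) λ ())

  unmarked⇒≥ : ∀ {p} → below p ≡ false → e ≤ p
  unmarked⇒≥ unmarked = ≮⇒≥ (λ p<e → contradiction (trans (sym (<⇒marked p<e)) unmarked) λ ())

  count-below : ∀ q → count below q ≡ q ⊓ e
  count-below zero = refl
  count-below (suc q) with q <? e
  ... | yes q<e = begin
    count below (suc q)  ≡⟨ count-true below (<⇒marked q<e) ⟩
    suc (count below q)  ≡⟨ cong suc (count-below q) ⟩
    suc (q ⊓ e)          ≡⟨ cong suc (m≤n⇒m⊓n≡m (<⇒≤ q<e)) ⟩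
    suc q                ≡⟨ m≤n⇒m⊓n≡m q<e ⟨
    suc q ⊓ e            ∎
  ... | no q≮e = begin
    count below (suc q)  ≡⟨ count-false below (≥⇒unmarked (≮⇒≥ q≮e)) ⟩
    count below q        ≡⟨ count-below q ⟩
    q ⊓ e                ≡⟨ m≥n⇒m⊓n≡n (≮⇒≥ q≮e) ⟩
    e                    ≡⟨ m≥n⇒m⊓n≡n (m≤n⇒m≤1+n (≮⇒≥ q≮e)) ⟨
    suc q ⊓ e            ∎

  κ≡e : κ ≡ e
  κ≡e = trans (count-below m) (m≥n⇒m⊓n≡n (m≤n⇒m≤1+n e≤2a))

  base-id : ∀ p → base p ≡ p
  base-id p with marked-or-unmarked p
  ... | inj₁ marked = begin
    base p             ≡⟨ base-marked marked ⟩
    count below p      ≡⟨ count-below p ⟩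
    p ⊓ e              ≡⟨ m≤n⇒m⊓n≡m (<⇒≤ (marked⇒< marked)) ⟩
    p                  ∎
  ... | inj₂ unmarked = begin
    base p                                 ≡⟨ base-unmarked unmarked ⟩
    κ + count (not ∘ below) p              ≡⟨ cong (_+ count (not ∘ below) p) (trans κ≡e (sym count≡e)) ⟩
    count below p + count (not ∘ below) p  ≡⟨ count-+-count-not below p ⟩
    p                                      ∎
    where
    count≡e : count below p ≡ e
    count≡e = trans (count-below p) (m≥n⇒m⊓n≡n (unmarked⇒≥ unmarked))

  colour-sum-or-sum∸m : ∀ s → colour s ≡ s ⊎ colour s + m ≡ s
  colour-sum-or-sum∸m s with low-or-high s
  ... | inj₁ s<m = inj₁ (trans (colour-low s<m) (base-id s))
  ... | inj₂ (p , refl) with marked-or-unmarked p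
  ...   | inj₁ marked   = inj₁ (trans (colour-high-marked marked)
                                      (cong (_+ m) (trans (sym (base-marked marked)) (base-id p))))
  ...   | inj₂ unmarked = inj₂ (cong (_+ m) (trans (colour-high-unmarked unmarked) (base-id p)))

  double+m≢double : ∀ i j → i + i + m ≢ j + j
  double+m≢double i j eq = double≢suc-double j (i + a) (trans (sym eq) (shift i a))
    where
    shift : ∀ i a → i + i + suc (a + a) ≡ suc ((i + a) + (i + a))
    shift = solve-∀

  diagonal-injective : ∀ {i j} → i < m → j < m → colour (i + i) ≡ colour (j + j) → i ≡ j
  diagonal-injective {i} {j} _ _ eq with colour-sum-or-sum∸m (i + i) | colour-sum-or-sum∸m (j + j)
  ... | inj₁ ci | inj₁ cj = double-injective (trans (sym ci) (trans eq cj))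
  ... | inj₂ ci | inj₂ cj = double-injective (trans (sym ci) (trans (cong (_+ m) eq) cj))
  ... | inj₁ ci | inj₂ cj = contradiction (trans (cong (_+ m) (trans (sym ci) eq)) cj) (double+m≢double i j)
  ... | inj₂ ci | inj₁ cj = contradiction (trans (cong (_+ m) (trans (sym cj) (sym eq))) ci) (double+m≢double j i)

  inT : InT (e + m) (K m)
  inT = subst (λ t → InT (t + m) (K m)) κ≡e
          (windowColouring⇒InT (shiftColouring (≥⇒unmarked e≤2a) diagonal-injective))

even : ℕ → Bool
even zero    = true
even (suc p) = not (even p)

even-double : ∀ x → even (x + x) ≡ true
even-double zero    = refl
even-double (suc x) rewrite +-suc x x = trans (not-involutive (even (x + x))) (even-double x)

module EvenComplete (a k : ℕ) (k≤a : k ≤ a) where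

  n : ℕ
  n = suc a

  mark : ℕ → Bool
  mark p = does (p <? k + k) ∨ even p

  open ShiftColouring (a + n) mark

  double-marked : ∀ x → mark (x + x) ≡ true
  double-marked x rewrite even-double x = ∨-zeroʳ _

  odd-unmarked : ∀ {x} → k ≤ x → mark (suc (x + x)) ≡ false
  odd-unmarked {x} k≤x
    rewrite dec-false (suc (x + x) <? k + k) (≤⇒≯ (m≤n⇒m≤1+n (+-mono-≤ k≤x k≤x)))
          | even-double x = refl

  count-double : ∀ j → count mark ((k + j) + (k + j)) ≡ k + k + j
  count-double zero rewrite +-identityʳ k | +-identityʳ (k + k) =
    count-all mark (λ {p} p<2k → cong (_∨ even p) (dec-true (p <? k + k) p<2k))
  count-double (suc j) = begin
    count mark ((k + suc j) + (k + suc j))           ≡⟨ cong (count mark) (step k j) ⟩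
    count mark (suc (suc ((k + j) + (k + j))))       ≡⟨ count-false mark (odd-unmarked (m≤m+n k j)) ⟩
    count mark (suc ((k + j) + (k + j)))             ≡⟨ count-true mark (double-marked (k + j)) ⟩
    suc (count mark ((k + j) + (k + j)))             ≡⟨ cong suc (count-double j) ⟩
    suc (k + k + j)                                  ≡⟨ +-suc (k + k) j ⟨
    k + k + suc j                                    ∎
    where
    step : ∀ k j → (k + suc j) + (k + suc j) ≡ suc (suc ((k + j) + (k + j)))
    step = solve-∀

  κ≡2k+[n∸k] : κ ≡ k + k + (n ∸ k)
  κ≡2k+[n∸k] = trans (cong (λ z → count mark (z + z)) (sym (m+[n∸m]≡n (m≤n⇒m≤1+n k≤a))))
             (count-double (n ∸ k))

  last-unmarked : mark (a + n) ≡ false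
  last-unmarked = subst (λ z → mark z ≡ false) (sym (+-suc a a)) (odd-unmarked k≤a)

  colour-double-low : ∀ {i} → i < n → colour (i + i) ≡ count mark (i + i)
  colour-double-low {i} i<n = trans (colour-low (+-mono-< i<n i<n)) (base-marked (double-marked i))

  colour-double-high : ∀ x → colour ((x + n) + (x + n)) ≡ count mark (x + x) + m
  colour-double-high x = trans (cong colour (regroup x n)) (colour-high-marked (double-marked x))
    where
    regroup : ∀ x n → (x + n) + (x + n) ≡ (x + x) + (n + n)
    regroup = solve-∀

  low-or-high-vertex : ∀ i → i < n ⊎ ∃ λ x → i ≡ x + n
  low-or-high-vertex i with i <? n
  ... | yes i<n = inj₁ i<n
  ... | no i≮n  = inj₂ (i ∸ n , sym (m∸n+n≡m (≮⇒≥ i≮n)))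

  low≢high : ∀ {i} → i < n → ∀ y → colour (i + i) ≢ colour ((y + n) + (y + n))
  low≢high {i} i<n y eq = <⇒≢ (<-≤-trans count<m (m≤n+m m (count mark (y + y))))
    (trans (sym (colour-double-low i<n)) (trans eq (colour-double-high y)))
    where
    count<m : count mark (i + i) < m
    count<m = ≤-<-trans (count-≤ mark (i + i)) (+-mono-< i<n i<n)

  diagonal-injective : ∀ {i j} → i < m → j < m → colour (i + i) ≡ colour (j + j) → i ≡ j
  diagonal-injective {i} {j} _ _ eq with low-or-high-vertex i | low-or-high-vertex j
  ... | inj₁ i<n | inj₁ j<n = double-injective (count-injective mark (double-marked i) (double-marked j)
          (trans (sym (colour-double-low i<n)) (trans eq (colour-double-low j<n))))
  ... | inj₂ (x , refl) | inj₂ (y , refl) = cong (_+ n) (double-injective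
          (count-injective mark (double-marked x) (double-marked y) (+-cancelʳ-≡ m _ _
            (trans (sym (colour-double-high x)) (trans eq (colour-double-high y))))))
  ... | inj₁ i<n | inj₂ (y , refl) = contradiction eq (low≢high i<n y)
  ... | inj₂ (x , refl) | inj₁ j<n = contradiction (sym eq) (low≢high j<n x)

  inT : InT (k + k + (n ∸ k) + (n + n)) (K (n + n))
  inT = subst (λ t → InT (t + m) (K m)) κ≡2k+[n∸k]
          (windowColouring⇒InT (shiftColouring last-unmarked diagonal-injective))

InT-K-odd : ∀ a t → suc (a + a) ≤ t → t ≤ suc (a + a) + (a + a) → InT t (K (suc (a + a)))
InT-K-odd a t m≤t t≤ = subst (λ t → InT t (K (suc (a + a)))) (m∸n+n≡m m≤t)
  (OddComplete.inT a (t ∸ suc (a + a)) (m≤n+o⇒m∸n≤o t (suc (a + a)) t≤))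

InT-K-even : ∀ a t → 3 * suc a ≤ t → t < 4 * suc a → InT t (K (suc a + suc a))
InT-K-even a t 3n≤t t<4n = subst (λ t → InT t (K (n + n))) colours≡t (EvenComplete.inT a k k≤a)
  where
  n = suc a
  k = t ∸ 3 * n
  k≤a : k ≤ a
  k≤a = s≤s⁻¹ (∸-<-from 3n≤t (subst (t <_) (4n≡3n+n n) t<4n))
    where
    4n≡3n+n : ∀ n → 4 * n ≡ 3 * n + n
    4n≡3n+n = solve-∀
  n≡k+d : n ≡ k + (n ∸ k)
  n≡k+d = sym (m+[n∸m]≡n (m≤n⇒m≤1+n k≤a))
  colours≡t : k + k + (n ∸ k) + (n + n) ≡ t
  colours≡t = begin
    k + k + (n ∸ k) + (n + n)                             ≡⟨ cong (λ z → k + k + (n ∸ k) + (z + z)) n≡k+d ⟩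
    k + k + (n ∸ k) + ((k + (n ∸ k)) + (k + (n ∸ k)))     ≡⟨ regroup k (n ∸ k) ⟩
    3 * (k + (n ∸ k)) + k                                 ≡⟨ cong (λ z → 3 * z + k) n≡k+d ⟨
    3 * n + k                                             ≡⟨ m+[n∸m]≡n 3n≤t ⟩
    t                                                     ∎
    where
    regroup : ∀ k d → k + k + d + ((k + d) + (k + d)) ≡ 3 * (k + d) + k
    regroup = solve-∀

theorem11 : ∀ (n : ℕ) → 1 ≤ n →
    (∀ t → 2 * n ∸ 1 ≤ t → t ≤ 4 * n ∸ 3 → InT t (K (2 * n ∸ 1)))
    × (∀ t → 3 * n ≤ t → t ≤ 4 * n ∸ 1 → InT t (K (2 * n)))
theorem11 (suc a) _ = odd-order , even-order
  where
  m≡2a+1 : 2 * suc a ∸ 1 ≡ suc (a + a)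
  m≡2a+1 = cong (_∸ 1) (2n≡ a)
    where
    2n≡ : ∀ a → 2 * suc a ≡ suc (suc (a + a))
    2n≡ = solve-∀

  top≡ : 4 * suc a ∸ 3 ≡ suc (a + a) + (a + a)
  top≡ = cong (_∸ 3) (4n≡ a)
    where
    4n≡ : ∀ a → 4 * suc a ≡ 3 + (suc (a + a) + (a + a))
    4n≡ = solve-∀

  odd-order : ∀ t → 2 * suc a ∸ 1 ≤ t → t ≤ 4 * suc a ∸ 3 → InT t (K (2 * suc a ∸ 1))
  odd-order t lo hi = subst (λ m → InT t (K m)) (sym m≡2a+1)
    (InT-K-odd a t (subst (_≤ t) m≡2a+1 lo) (subst (t ≤_) top≡ hi))

  even-order : ∀ t → 3 * suc a ≤ t → t ≤ 4 * suc a ∸ 1 → InT t (K (2 * suc a))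
  even-order t lo hi = subst (λ m → InT t (K (suc a + m))) (sym (+-identityʳ (suc a)))
    (InT-K-even a t lo (s≤s hi))
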